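{- Let $S$ be a set and $\mathcal{J}$ a reduction on $S$. Then for all $a\in S$ and $U\subseteq S$, $$\big(a\in\mathcal{J}(S)\Rightarrow a\in\mathbb{A}(\mathcal{J})(U)\big)\Longrightarrow a\in\mathbb{A}(\mathcal{J})(U).$$
   Context: All reasoning is intuitionistic (no law of excluded middle). A reduction on $S$ is a monotone idempotent map $\mathcal{J}:\mathrm{Pow}(S)\to\mathrm{Pow}(S)$ with $\mathcal{J}(U)\subseteq U$ for all $U$. For $U,V\subseteq S$, $U\between V$ means there exists $a\in U\cap V$. $\mathbb{A}(\mathcal{J})$ is the greatest saturation compatible with $\mathcal{J}$; explicitly, $a\in\mathbb{A}(\mathcal{J})(U)$ iff for all $V\subseteq S$, $a\in\mathcal{J}(V)$ implies $U\between\mathcal{J}(V)$. -}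

module Defs where

open import Level using (Level; _⊔_; suc)
open import Relation.Unary using (Pred; _⊆_; _∩_; _∈_; Satisfiable)
open import Data.Product using (_×_; ∃; _,_)
open import Function using (_∘_)
open import Data.Unit using (⊤)

Whole : ∀ {a ℓ} (S : Set a) → Pred S ℓ
Whole S = λ _ → Level.Lift _ ⊤

_≐_ : ∀ {a ℓ} {S : Set a} → Pred S ℓ → Pred S ℓ → Set (a ⊔ ℓ)
U ≐ V = (U ⊆ V) × (V ⊆ U)

_≬_ : ∀ {a ℓ} {S : Set a} → Pred S ℓ → Pred S ℓ → Set (a ⊔ ℓ)
U ≬ V = ∃ λ x → (x ∈ U) × (x ∈ V)

record IsReduction {a ℓ} {S : Set a} (J : Pred S ℓ → Pred S ℓ) : Set (Level.suc (a ⊔ ℓ)) where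
  field
    monotone     : ∀ {U V} → U ⊆ V → J U ⊆ J V
    idempotent   : ∀ U → J (J U) ≐ J U
    deflationary : ∀ U → J U ⊆ U

𝔸 : ∀ {a ℓ} {S : Set a} → (Pred S ℓ → Pred S ℓ) → Pred S ℓ → Pred S (a ⊔ Level.suc ℓ)
𝔸 {S = S} J U x = ∀ (V : Pred S _) → x ∈ J V → U ≬ J V

module Submission where

open import Defs
open import Relation.Unary using (Pred; _⊆_; _∈_)

-- Monotonicity alone suffices: x ∈ J V ⊆ J S supplies the hypothesis.
module _ {a ℓ} {S : Set a} {J : Pred S ℓ → Pred S ℓ} (isReduction : IsReduction J) where

  open IsReduction isReduction

  J⊆J-Whole : ∀ V → J V ⊆ J (Whole S)
  J⊆J-Whole V = monotone (λ _ → _)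

lemma4p2 : ∀ {a ℓ} {S : Set a} (J : Pred S ℓ → Pred S ℓ) → IsReduction J →
    ∀ (x : S) (U : Pred S ℓ) →
    (x ∈ J (Whole S) → x ∈ 𝔸 J U) → x ∈ 𝔸 J U
lemma4p2 J isReduction x U h V x∈JV = h (J⊆J-Whole isReduction V x∈JV) V x∈JV
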